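{- Let $G=(V,E,\varphi)$ be a loop-free graph whose edge-set carries a linear order $<$, let $e$ be the minimum edge of $G$, and let $X\subseteq E$ with $e\in X$. If $X$ includes no broken circuit of $G$ as a subset, then (a) $X\setminus\{e\}\subseteq E(G|_e)$, and (b) $X\setminus\{e\}$ includes no broken circuit of $G|_e$ as a subset.
   Context: A graph is a triple $G=(V,E,\varphi)$ where $\varphi$ maps each edge to a one- or two-element subset of $V$; loop-free means $|\varphi(x)|=2$ for every edge (parallel edges allowed). A set $D\subseteq E$ is the edge-set of a cycle of $G$ if $D=\{x_1,\dots,x_k\}$, $k\ge1$, distinct edges, with distinct vertices $v_1,\dots,v_k$ such that $\varphi(x_i)=\{v_i,v_{i+1}\}$ (indices mod $k$). A broken circuit of $G$ is $D\setminus\{\max D\}$ for such $D$, maximum in the linear order. Contraction: define $\sim_e$ on $V$ by $v\sim_e w$ iff $v=w$ or $\varphi(e)=\{v,w\}$, and on $E\setminus\{e\}$ by $x\sim_e y$ iff $x=y$ or $\varphi(e)=\varphi(x)\,\triangle\,\varphi(y)$ (symmetric difference), taken as an equivalence relation; write $[\cdot]_e$ for classes. Then $G|_e$ has vertex set $V/\!\sim_e$, edge set $(E\setminus\{e\})/\!\sim_e$, and incidence $\varphi_e([x]_e)=\{[v]_e : v\in\varphi(x)\}$. Each edge class $[x]_e$ is identified with its maximum element in the linear order of $E$, so $E(G|_e)\subseteq E\setminus\{e\}$ consists of the maxima of the classes and inherits the linear order; cycles and broken circuits of $G|_e$ are defined as for $G$ using $\varphi_e$. -}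

module Defs where

open import Level using (0ℓ)
open import Data.Nat using (ℕ; zero; suc; _<?_)
open import Data.Fin using (Fin; zero; suc; toℕ; fromℕ<)
open import Data.Product using (Σ; ∃; _×_; _,_)
open import Data.Sum using (_⊎_)
open import Data.Unit using (⊤)
open import Relation.Nullary using (¬_; yes; no)
open import Relation.Unary using (Pred)
open import Relation.Binary using (Rel)
open import Relation.Binary.PropositionalEquality using (_≡_; _≢_)
open import Relation.Binary.Construct.Closure.ReflexiveTransitive using (Star)

next : ∀ {n} → Fin (suc n) → Fin (suc n)
next {n} i with suc (toℕ i) <? suc n
... | yes p = fromℕ< p
... | no _  = zero

-- A finite graph: vertices Fin n, edges Fin m; each edge x has endpoints
-- src x, tgt x, so φ(x) = {src x, tgt x} (size 1 iff src x ≡ tgt x).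
record Graph (n m : ℕ) : Set where
  field
    src : Fin m → Fin n
    tgt : Fin m → Fin n
open Graph public

LoopFree : ∀ {n m} → Graph n m → Set
LoopFree G = ∀ x → src G x ≢ tgt G x

-- equality of sets {a,b} = {c,d} up to a relation _≈_ on (representatives of) elements
PairEq : {A : Set} → (A → A → Set) → A → A → A → A → Set
PairEq _≈_ a b c d = (a ≈ c × b ≈ d) ⊎ (a ≈ d × b ≈ c)

_∈φ_ : ∀ {n m} {G : Graph n m} → Fin n → Fin m → Set
_∈φ_ {G = G} v x = v ≡ src G x ⊎ v ≡ tgt G x

_Xor_ : Set → Set → Set
A Xor B = (A × ¬ B) ⊎ (¬ A × B)

_⇔_ : Set → Set → Set
A ⇔ B = (A → B) × (B → A)

-- Cycles and broken circuits of a "graph-like" structure whose edges are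
-- a subset EdgeIn of Fin m (ordered by _<_), vertices are elements of Vtx
-- compared by _≈_, and Inc x u w means φ(x) = {u , w}.

module _ {m : ℕ} where

  record Cycle (Vtx : Set) (_≈_ : Vtx → Vtx → Set) (EdgeIn : Pred (Fin m) 0ℓ)
               (Inc : Fin m → Vtx → Vtx → Set) : Set where
    field
      k        : ℕ                         -- the cycle has length suc k ≥ 1
      edge     : Fin (suc k) → Fin m
      vtx      : Fin (suc k) → Vtx
      edge-in  : ∀ i → EdgeIn (edge i)
      edge-inj : ∀ i j → edge i ≡ edge j → i ≡ j
      vtx-inj  : ∀ i j → vtx i ≈ vtx j → i ≡ j
      inc      : ∀ i → Inc (edge i) (vtx i) (vtx (next i))

  InCycle : ∀ {Vtx ≈ EdgeIn Inc} → Cycle Vtx ≈ EdgeIn Inc → Pred (Fin m) 0ℓ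
  InCycle C y = ∃ λ i → Cycle.edge C i ≡ y

  IsMaxOf : (_<_ : Rel (Fin m) 0ℓ) → ∀ {Vtx ≈ EdgeIn Inc} →
            Cycle Vtx ≈ EdgeIn Inc → Fin m → Set
  IsMaxOf _<_ C t = InCycle C t × (∀ y → InCycle C y → y ≢ t → y < t)

  NoBrokenCircuit : (_<_ : Rel (Fin m) 0ℓ) (Vtx : Set) (_≈_ : Vtx → Vtx → Set)
                    (EdgeIn : Pred (Fin m) 0ℓ) (Inc : Fin m → Vtx → Vtx → Set) →
                    Pred (Fin m) 0ℓ → Set
  NoBrokenCircuit _<_ Vtx _≈_ EdgeIn Inc X =
    (C : Cycle Vtx _≈_ EdgeIn Inc) (t : Fin m) → IsMaxOf _<_ C t →
    ¬ (∀ y → InCycle C y → y ≢ t → X y)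

IncG : ∀ {n m} → Graph n m → Fin m → Fin n → Fin n → Set
IncG G x u w = PairEq _≡_ (src G x) (tgt G x) u w

NoBC-G : ∀ {n m} → Graph n m → Rel (Fin m) 0ℓ → Pred (Fin m) 0ℓ → Set
NoBC-G {n} G _<_ X = NoBrokenCircuit _<_ (Fin n) _≡_ (λ _ → ⊤) (IncG G) X

module _ {n m : ℕ} (G : Graph n m) (e : Fin m) where

  _∼v_ : Fin n → Fin n → Set
  v ∼v w = v ≡ w ⊎ PairEq _≡_ (src G e) (tgt G e) v w

  EdgeStep : Fin m → Fin m → Set
  EdgeStep x y = x ≢ e × y ≢ e ×
    (x ≡ y ⊎ (∀ v → _∈φ_ {G = G} v e ⇔ (_∈φ_ {G = G} v x Xor _∈φ_ {G = G} v y)))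

  -- ∼_e on edges: the equivalence relation generated (EdgeStep is symmetric,
  -- so its reflexive-transitive closure is the generated equivalence)
  _∼e_ : Fin m → Fin m → Set
  x ∼e y = Star EdgeStep x y

  -- E(G|_e): the edges x ≠ e that are the maximum of their class [x]_e
  EdgeOfContr : Rel (Fin m) 0ℓ → Pred (Fin m) 0ℓ
  EdgeOfContr _<_ x = x ≢ e × (∀ y → x ∼e y → y ≡ x ⊎ y < x)

  -- vertices of G|_e are represented by vertices of G, compared by ∼_e;
  -- φ_e([x]_e) = {[src x]_e , [tgt x]_e}
  IncContr : Fin m → Fin n → Fin n → Set
  IncContr x u w = PairEq _∼v_ (src G x) (tgt G x) u w

  NoBC-Contr : Rel (Fin m) 0ℓ → Pred (Fin m) 0ℓ → Set
  NoBC-Contr _<_ X =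
    NoBrokenCircuit _<_ (Fin n) _∼v_ (EdgeOfContr _<_) IncContr X

-- Write ≈ for the identification of the two ends of e, so that the ends of
-- an edge x in G|_e are the ≈-classes of the ends of x in G.
--
-- (b) The heart of the proof: a cycle C of G|_e with maximum t whose other
-- edges lie in X is impossible.  Lift every edge of C to an edge of G with
-- concrete endpoints a_i, b_i.  Consecutive lifts either meet (b_i = a_{i+1})
-- or are "mismatched", in which case {b_i, a_{i+1}} is the edge e; since the
-- vertices of C are distinct modulo ≈, at most one mismatch occurs.  With no
-- mismatch the lifts form a cycle of G with the same edges; with one mismatch
-- we rotate it to the last position and close the gap with e, which is
-- smaller than t and lies in X.  Either way G has a broken circuit inside X.
--
-- (a) Every edge y in the class of x has the same ends as x in G|_e, so for
-- y > x the edges x, y form a 2-cycle of G|_e with maximum y, again excluded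
-- by (b); the 2-cycle is genuine because x is not parallel to e in G.
module Submission where

open import Defs
open import Level using (0ℓ)
open import Data.Nat using (ℕ; zero; suc; _<?_; s≤s)
import Data.Nat.Properties as ℕ
open import Data.Fin using (Fin; zero; suc; toℕ; fromℕ; inject₁)
open import Data.Fin.Properties
  using (toℕ-injective; toℕ-fromℕ; toℕ-fromℕ<; toℕ-inject₁; inject₁ℕ<; suc-injective;
         fromℕ≢inject₁; _≟_; all?; ¬∀⟶∃¬)
open import Data.Product using (∃; _×_; _,_; proj₁; proj₂; uncurry)
open import Data.Sum using (_⊎_; inj₁; inj₂; [_,_])
open import Data.Empty using (⊥; ⊥-elim)
open import Data.Unit using (⊤; tt)
open import Function using (_∘_)
open import Relation.Nullary using (¬_; Dec; yes; no)
open import Relation.Nullary.Decidable using (decidable-stable)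
open import Relation.Unary using (Pred; _⊆_)
open import Relation.Binary using (Rel; IsStrictTotalOrder; Reflexive; Symmetric; Transitive; tri<; tri≈; tri>)
open import Relation.Binary.PropositionalEquality
  using (_≡_; _≢_; refl; sym; trans; cong; subst)
open import Relation.Binary.Construct.Closure.ReflexiveTransitive using (ε; _◅_)

data Position : (k : ℕ) → Fin (suc k) → Set where
  last  : ∀ {k} → Position k (fromℕ k)
  below : ∀ {k} (j : Fin k) → Position k (inject₁ j)

position : ∀ {k} (i : Fin (suc k)) → Position k i
position {zero}  zero    = last
position {suc k} zero    = below zero
position {suc k} (suc i) with position i
... | last    = last
... | below j = below (suc j)

next-last : ∀ k → next (fromℕ k) ≡ zero
next-last k with suc (toℕ (fromℕ k)) <? suc k
... | yes p = ⊥-elim (ℕ.<-irrefl (cong suc (toℕ-fromℕ k)) p)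
... | no _  = refl

next-inject₁ : ∀ {k} (j : Fin k) → next (inject₁ j) ≡ suc j
next-inject₁ {k} j with suc (toℕ (inject₁ j)) <? suc k
... | yes p  = toℕ-injective (trans (toℕ-fromℕ< p) (cong suc (toℕ-inject₁ j)))
... | no ¬p  = ⊥-elim (¬p (s≤s (inject₁ℕ< j)))

next-injective : ∀ {k} (i j : Fin (suc k)) → next i ≡ next j → i ≡ j
next-injective {k} i j eq with position i | position j
... | last     | last     = refl
... | last     | below j′ with () ← trans (sym (next-last k)) (trans eq (next-inject₁ j′))
... | below i′ | last     with () ← trans (sym (next-inject₁ i′)) (trans eq (next-last k))
... | below i′ | below j′ =
  cong inject₁ (suc-injective (trans (sym (next-inject₁ i′)) (trans eq (next-inject₁ j′))))

next-surjective : ∀ {k} (j : Fin (suc k)) → ∃ λ i → next i ≡ j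
next-surjective {k} zero = fromℕ k , next-last k
next-surjective (suc j)  = inject₁ j , next-inject₁ j

module _ {A : Set} {_R_ : A → A → Set} where

  pair-refl : Reflexive _R_ → ∀ {a b} → PairEq _R_ a b a b
  pair-refl r = inj₁ (r , r)

  pair-sym : Symmetric _R_ → ∀ {a b c d} → PairEq _R_ a b c d → PairEq _R_ c d a b
  pair-sym s (inj₁ (ac , bd)) = inj₁ (s ac , s bd)
  pair-sym s (inj₂ (ad , bc)) = inj₂ (s bc , s ad)

  pair-trans : Transitive _R_ → ∀ {a b c d f g} →
               PairEq _R_ a b c d → PairEq _R_ c d f g → PairEq _R_ a b f g
  pair-trans t (inj₁ (ac , bd)) (inj₁ (cf , dg)) = inj₁ (t ac cf , t bd dg)
  pair-trans t (inj₁ (ac , bd)) (inj₂ (cg , df)) = inj₂ (t ac cg , t bd df)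
  pair-trans t (inj₂ (ad , bc)) (inj₁ (cf , dg)) = inj₂ (t ad dg , t bc cf)
  pair-trans t (inj₂ (ad , bc)) (inj₂ (cg , df)) = inj₁ (t ad df , t bc cg)

  pair-swapˡ : ∀ {a b c d} → PairEq _R_ a b c d → PairEq _R_ b a c d
  pair-swapˡ (inj₁ (ac , bd)) = inj₂ (bd , ac)
  pair-swapˡ (inj₂ (ad , bc)) = inj₁ (bc , ad)

  pair-swapʳ : ∀ {a b c d} → PairEq _R_ a b c d → PairEq _R_ a b d c
  pair-swapʳ (inj₁ p) = inj₂ p
  pair-swapʳ (inj₂ p) = inj₁ p

module _ {A : Set} {p q a b : A} where

  pair-∈₁ : PairEq _≡_ p q a b → a ≡ p ⊎ a ≡ q
  pair-∈₁ (inj₁ (pa , _)) = inj₁ (sym pa)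
  pair-∈₁ (inj₂ (_ , qa)) = inj₂ (sym qa)

  pair-∈₂ : PairEq _≡_ p q a b → b ≡ p ⊎ b ≡ q
  pair-∈₂ (inj₁ (_ , qb)) = inj₂ (sym qb)
  pair-∈₂ (inj₂ (pb , _)) = inj₁ (sym pb)

  pair-⊆ : PairEq _≡_ p q a b → ∀ {v} → v ≡ p ⊎ v ≡ q → v ≡ a ⊎ v ≡ b
  pair-⊆ (inj₁ (pa , qb)) (inj₁ vp) = inj₁ (trans vp pa)
  pair-⊆ (inj₁ (pa , qb)) (inj₂ vq) = inj₂ (trans vq qb)
  pair-⊆ (inj₂ (pb , qa)) (inj₁ vp) = inj₂ (trans vp pb)
  pair-⊆ (inj₂ (pb , qa)) (inj₂ vq) = inj₁ (trans vq qa)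

  pair-from : a ≢ b → a ≡ p ⊎ a ≡ q → b ≡ p ⊎ b ≡ q → PairEq _≡_ p q a b
  pair-from a≢b (inj₁ ap) (inj₁ bp) = ⊥-elim (a≢b (trans ap (sym bp)))
  pair-from a≢b (inj₁ ap) (inj₂ bq) = inj₁ (sym ap , sym bq)
  pair-from a≢b (inj₂ aq) (inj₁ bp) = inj₂ (sym bp , sym aq)
  pair-from a≢b (inj₂ aq) (inj₂ bq) = ⊥-elim (a≢b (trans aq (sym bq)))

BrokenIn : ∀ {m} (_<_ : Rel (Fin m) 0ℓ) (X : Pred (Fin m) 0ℓ) {Vtx ≈ EdgeIn Inc} →
           Cycle Vtx ≈ EdgeIn Inc → Fin m → Set
BrokenIn _<_ X C t = IsMaxOf _<_ C t × (∀ y → InCycle C y → y ≢ t → X y)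

module _ {m : ℕ} (_<_ : Rel (Fin m) 0ℓ) (X : Pred (Fin m) 0ℓ) where

  extend-broken : ∀ {V V′ ≈ ≈′ E E′ I I′} {C : Cycle V ≈ E I} {C′ : Cycle V′ ≈′ E′ I′} {t}
                  (Extra : Pred (Fin m) 0ℓ) →
                  (∀ y → InCycle C′ y → Extra y ⊎ InCycle C y) →
                  (InCycle C t → InCycle C′ t) →
                  (∀ y → Extra y → y < t × X y) →
                  BrokenIn _<_ X C t → BrokenIn _<_ X C′ t
  extend-broken Extra split keep extra ((t∈C , smaller) , inX) =
    (keep t∈C , λ y y∈C′ y≢t → [ proj₁ ∘ extra y , (λ y∈C → smaller y y∈C y≢t) ] (split y y∈C′)) ,
    λ y y∈C′ y≢t → [ proj₂ ∘ extra y , (λ y∈C → inX y y∈C y≢t) ] (split y y∈C′)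

module _ {m : ℕ} {Vtx : Set} {_≈_ : Vtx → Vtx → Set} {EdgeIn : Pred (Fin m) 0ℓ}
         {Inc : Fin m → Vtx → Vtx → Set} where

  rotate : Cycle Vtx _≈_ EdgeIn Inc → Cycle Vtx _≈_ EdgeIn Inc
  rotate C = record
    { k        = k
    ; edge     = edge ∘ next
    ; vtx      = vtx ∘ next
    ; edge-in  = edge-in ∘ next
    ; edge-inj = λ i j → next-injective i j ∘ edge-inj (next i) (next j)
    ; vtx-inj  = λ i j → next-injective i j ∘ vtx-inj (next i) (next j)
    ; inc      = inc ∘ next
    }
    where open Cycle C

  -- rotation does not change the edge set
  rotate-broken : ∀ (_<_ : Rel (Fin m) 0ℓ) X {C t} → BrokenIn _<_ X C t → BrokenIn _<_ X (rotate C) t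
  rotate-broken _<_ X {C} =
    extend-broken _<_ X {C = C} {C′ = rotate C} (λ _ → ⊥) (λ y (i , p) → inj₂ (next i , p)) keep λ _ ()
    where
    keep : ∀ {t} → InCycle C t → InCycle (rotate C) t
    keep (j , p) with next-surjective j
    ... | i , refl = i , p

  parallel-bc : ∀ {_<_ X} → NoBrokenCircuit _<_ Vtx _≈_ EdgeIn Inc X →
                ∀ {x y u w} → x ≢ y → x < y → X x → EdgeIn x → EdgeIn y →
                ¬ u ≈ w → ¬ w ≈ u → Inc x u w → Inc y w u → ⊥
  parallel-bc {_<_} {X} nbc {x} {y} {u} {w} x≢y x<y Xx x-in y-in u≉w w≉u x-inc y-inc =
    nbc C y ((suc zero , refl) , y-max) rest-in-X
    where
    C : Cycle Vtx _≈_ EdgeIn Inc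
    C = record
      { k        = 1
      ; edge     = λ { zero → x ; (suc zero) → y }
      ; vtx      = λ { zero → u ; (suc zero) → w }
      ; edge-in  = λ { zero → x-in ; (suc zero) → y-in }
      ; edge-inj = λ { zero zero _ → refl ; zero (suc zero) p → ⊥-elim (x≢y p)
                     ; (suc zero) zero p → ⊥-elim (x≢y (sym p)) ; (suc zero) (suc zero) _ → refl }
      ; vtx-inj  = λ { zero zero _ → refl ; zero (suc zero) p → ⊥-elim (u≉w p)
                     ; (suc zero) zero p → ⊥-elim (w≉u p) ; (suc zero) (suc zero) _ → refl }
      ; inc      = λ { zero → x-inc ; (suc zero) → y-inc }
      }
    y-max : ∀ z → InCycle C z → z ≢ y → z < y
    y-max z (zero , refl)     _   = x<y
    y-max z (suc zero , refl) z≢y = ⊥-elim (z≢y refl)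
    rest-in-X : ∀ z → InCycle C z → z ≢ y → X z
    rest-in-X z (zero , refl)     _   = Xx
    rest-in-X z (suc zero , refl) z≢y = ⊥-elim (z≢y refl)

  narrow : ∀ {EdgeIn′ : Pred (Fin m) 0ℓ} → EdgeIn′ ⊆ EdgeIn →
           Cycle Vtx _≈_ EdgeIn′ Inc → Cycle Vtx _≈_ EdgeIn Inc
  narrow sub C = record
    { k = k ; edge = edge ; vtx = vtx ; edge-in = sub ∘ edge-in
    ; edge-inj = edge-inj ; vtx-inj = vtx-inj ; inc = inc }
    where open Cycle C

  nbc-mono : ∀ {_<_ X X′} {EdgeIn′ : Pred (Fin m) 0ℓ} → EdgeIn′ ⊆ EdgeIn → X′ ⊆ X →
             NoBrokenCircuit _<_ Vtx _≈_ EdgeIn Inc X → NoBrokenCircuit _<_ Vtx _≈_ EdgeIn′ Inc X′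
  nbc-mono sub X′⊆X nbc C t max inX′ = nbc (narrow sub C) t max (λ y y∈C y≢t → X′⊆X (inX′ y y∈C y≢t))

module Contraction {n m : ℕ} (G : Graph n m) (lf : LoopFree G) (e : Fin m) where

  infix 25 _∈_
  _∈_ : Fin n → Fin m → Set
  v ∈ x = _∈φ_ {G = G} v x

  ∈-dec : ∀ v x → Dec (v ∈ x)
  ∈-dec v x with v ≟ src G x | v ≟ tgt G x
  ... | yes p | _     = yes (inj₁ p)
  ... | no _  | yes q = yes (inj₂ q)
  ... | no p  | no q  = no λ { (inj₁ r) → p r ; (inj₂ r) → q r }

  _≈_ : Fin n → Fin n → Set
  _≈_ = _∼v_ G e

  ≈-refl : Reflexive _≈_
  ≈-refl = inj₁ refl

  ≈-sym : Symmetric _≈_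
  ≈-sym (inj₁ p)                = inj₁ (sym p)
  ≈-sym (inj₂ (inj₁ (p , q)))   = inj₂ (inj₂ (p , q))
  ≈-sym (inj₂ (inj₂ (p , q)))   = inj₂ (inj₁ (p , q))

  -- transitivity needs that e is not a loop
  ≈-trans : Transitive _≈_
  ≈-trans (inj₁ refl) q = q
  ≈-trans p (inj₁ refl) = p
  ≈-trans (inj₂ (inj₁ (_ , q))) (inj₂ (inj₁ (r , _))) = ⊥-elim (lf e (trans r (sym q)))
  ≈-trans (inj₂ (inj₁ (p , _))) (inj₂ (inj₂ (r , _))) = inj₁ (trans (sym p) r)
  ≈-trans (inj₂ (inj₂ (_ , q))) (inj₂ (inj₁ (_ , s))) = inj₁ (trans (sym q) s)
  ≈-trans (inj₂ (inj₂ (p , _))) (inj₂ (inj₂ (_ , s))) = ⊥-elim (lf e (trans p (sym s)))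

  ∈e⇒≈ : ∀ {v w} → v ∈ e → w ∈ e → v ≈ w
  ∈e⇒≈ (inj₁ p) (inj₁ q) = inj₁ (trans p (sym q))
  ∈e⇒≈ (inj₁ p) (inj₂ q) = inj₂ (inj₁ (sym p , sym q))
  ∈e⇒≈ (inj₂ p) (inj₁ q) = inj₂ (inj₂ (sym q , sym p))
  ∈e⇒≈ (inj₂ p) (inj₂ q) = inj₁ (trans p (sym q))

  ≈-distinct : ∀ {v w} → v ≈ w → v ≢ w → IncG G e v w
  ≈-distinct (inj₁ p) v≢w = ⊥-elim (v≢w p)
  ≈-distinct (inj₂ p) _   = p

  SameEnds : Fin m → Fin m → Set
  SameEnds x y = PairEq _≈_ (src G x) (tgt G x) (src G y) (tgt G y)

  SymDiff : Fin m → Fin m → Set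
  SymDiff x y = ∀ v → (v ∈ e) ⇔ ((v ∈ x) Xor (v ∈ y))

  -- φ(e) is nonempty, so φ(x) △ φ(y) cannot be empty.
  same-vertices-no-symdiff : ∀ {x y} → (∀ v → v ∈ x ⇔ v ∈ y) → ¬ SymDiff x y
  same-vertices-no-symdiff same d with proj₁ (d (src G e)) (inj₁ refl)
  ... | inj₁ (v∈x , v∉y) = v∉y (proj₁ (same _) v∈x)
  ... | inj₂ (v∉x , v∈y) = v∉x (proj₂ (same _) v∈y)

  -- If the end a of x lies on y and the other end c does not, then c and the
  -- other end of y both lie on e, so x and y have the same ends in G|_e.
  symdiff-shared-end : ∀ {x y a c} → SymDiff x y → IncG G x a c → a ∈ y → ¬ c ∈ y →
                       PairEq _≈_ a c (src G y) (tgt G y)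
  symdiff-shared-end {x} {y} {a} {c} d x-ac a∈y c∉y = ends a∈y
    where
    c∈e : c ∈ e
    c∈e = proj₂ (d c) (inj₁ (pair-∈₂ x-ac , c∉y))
    c≈other : ∀ {w} → w ∈ y → w ≢ a → c ≈ w
    c≈other {w} w∈y w≢a = ∈e⇒≈ c∈e (proj₂ (d w) (inj₂ (w∉x , w∈y)))
      where
      w∉x : ¬ w ∈ x
      w∉x w∈x with pair-⊆ x-ac w∈x
      ... | inj₁ w≡a = w≢a w≡a
      ... | inj₂ refl = c∉y w∈y
    ends : a ∈ y → PairEq _≈_ a c (src G y) (tgt G y)
    ends (inj₁ a≡s) = inj₁ (inj₁ a≡s , c≈other (inj₂ refl) λ t≡a → lf y (trans (sym a≡s) (sym t≡a)))
    ends (inj₂ a≡t) = inj₂ (inj₁ a≡t , c≈other (inj₁ refl) λ s≡a → lf y (trans s≡a a≡t))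

  -- φ(e) = φ(x) △ φ(y) forces x and y to share exactly one end.
  symdiff-same-ends : ∀ {x y} → SymDiff x y → SameEnds x y
  symdiff-same-ends {x} {y} d with ∈-dec (src G x) y | ∈-dec (tgt G x) y
  ... | yes s∈y | yes t∈y = ⊥-elim (same-vertices-no-symdiff (λ v → x⊆y , y⊆x) d)
    where
    x⊆y : ∀ {v} → v ∈ x → v ∈ y
    x⊆y (inj₁ refl) = s∈y
    x⊆y (inj₂ refl) = t∈y
    y⊆x : ∀ {v} → v ∈ y → v ∈ x
    y⊆x = pair-⊆ (pair-from (lf x) s∈y t∈y)
  ... | yes s∈y | no t∉y  = symdiff-shared-end {x} {y} d (inj₁ (refl , refl)) s∈y t∉y
  ... | no s∉y  | yes t∈y = pair-swapˡ {_R_ = _≈_} (symdiff-shared-end {x} {y} d (inj₂ (refl , refl)) t∈y s∉y)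
  ... | no s∉y  | no t∉y  = ⊥-elim (sy∉x (pair-⊆ x=e sy∈e))
    where
    x=e : IncG G e (src G x) (tgt G x)
    x=e = pair-from (lf x) (proj₂ (d _) (inj₁ (inj₁ refl , s∉y)))
                           (proj₂ (d _) (inj₁ (inj₂ refl , t∉y)))
    sy∉x : ¬ src G y ∈ x
    sy∉x (inj₁ p) = s∉y (subst (_∈ y) p (inj₁ refl))
    sy∉x (inj₂ p) = t∉y (subst (_∈ y) p (inj₁ refl))
    sy∈e : src G y ∈ e
    sy∈e = proj₂ (d _) (inj₂ (sy∉x , inj₁ refl))

  class-same-ends : ∀ {x y} → x ≢ e → _∼e_ G e x y → y ≢ e × SameEnds x y
  class-same-ends x≢e ε = x≢e , pair-refl {_R_ = _≈_} ≈-refl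
  class-same-ends {x} _ (_◅_ {j = z} (_ , z≢e , step) steps) with class-same-ends z≢e steps
  ... | y≢e , ends = y≢e , pair-trans {_R_ = _≈_} ≈-trans (step-ends step) ends
    where
    step-ends : x ≡ z ⊎ SymDiff x z → SameEnds x z
    step-ends (inj₁ refl) = pair-refl {_R_ = _≈_} ≈-refl
    step-ends (inj₂ d)    = symdiff-same-ends {x} {z} d

  record Lifted (x : Fin m) (u w : Fin n) : Set where
    field
      start end : Fin n
      start≈    : start ≈ u
      end≈      : end ≈ w
      incident  : IncG G x start end

  lift : ∀ {x u w} → IncContr G e x u w → Lifted x u w
  lift (inj₁ (s≈u , t≈w)) = record { start = _ ; end = _ ; start≈ = s≈u ; end≈ = t≈w
                                   ; incident = inj₁ (refl , refl) }
  lift (inj₂ (s≈w , t≈u)) = record { start = _ ; end = _ ; start≈ = t≈u ; end≈ = s≈w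
                                   ; incident = inj₂ (refl , refl) }

  ContrCycle : Set
  ContrCycle = Cycle (Fin n) _≈_ (_≢ e) (IncContr G e)

  module Lifting (C : ContrCycle) where
    open Cycle C

    a b : Fin (suc k) → Fin n
    a i = Lifted.start (lift (inc i))
    b i = Lifted.end (lift (inc i))

    Matched : Fin (suc k) → Set
    Matched i = b i ≡ a (next i)

    matched? : ∀ i → Dec (Matched i)
    matched? i = b i ≟ a (next i)

    -- the starts of the lifts are distinct, as the vertices of C are
    a-injective : ∀ i j → a i ≡ a j → i ≡ j
    a-injective i j p = vtx-inj i j (≈-trans (≈-sym (Lifted.start≈ (lift (inc i))))
                                      (subst (_≈ vtx j) (sym p) (Lifted.start≈ (lift (inc j)))))

    end-meets-start : ∀ {i j} → b i ≡ a j → j ≡ next i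
    end-meets-start {i} {j} p = vtx-inj j (next i)
      (≈-trans (≈-sym (Lifted.start≈ (lift (inc j))))
               (subst (_≈ vtx (next i)) p (Lifted.end≈ (lift (inc i)))))

    bridge : ∀ i → b i ≈ a (next i)
    bridge i = ≈-trans (Lifted.end≈ (lift (inc i))) (≈-sym (Lifted.start≈ (lift (inc (next i)))))

    -- a mismatch happens at the ends of e ...
    mismatch-at-e : ∀ {i} → ¬ Matched i → IncG G e (b i) (a (next i))
    mismatch-at-e {i} = ≈-distinct (bridge i)

    -- ... hence at most once, since the vertices of C are distinct modulo ≈
    mismatch-unique : ∀ {i j} → ¬ Matched i → ¬ Matched j → i ≡ j
    mismatch-unique {i} {j} mis-i mis-j = next-injective i j (vtx-inj (next i) (next j)
      (≈-trans (≈-sym (Lifted.end≈ (lift (inc i))))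
               (≈-trans (∈e⇒≈ (pair-∈₁ (mismatch-at-e mis-i)) (pair-∈₁ (mismatch-at-e mis-j))) (Lifted.end≈ (lift (inc j))))))

    cycle-of-lifts : (∀ i → Matched i) → Cycle (Fin n) _≡_ (λ _ → ⊤) (IncG G)
    cycle-of-lifts match = record
      { k = k ; edge = edge ; vtx = a ; edge-in = λ _ → tt ; edge-inj = edge-inj
      ; vtx-inj = a-injective
      ; inc = λ i → subst (IncG G (edge i) (a i)) (match i) (Lifted.incident (lift (inc i))) }

    cycle-through-e : ¬ Matched (fromℕ k) → (∀ i → i ≢ fromℕ k → Matched i) →
                      Cycle (Fin n) _≡_ (λ _ → ⊤) (IncG G)
    cycle-through-e mis match = record
      { k = suc k ; edge = edge′ ; vtx = vtx′ ; edge-in = λ _ → tt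
      ; edge-inj = edge-inj′ ; vtx-inj = vtx-inj′ ; inc = inc′ }
      where
      edge′ : Fin (suc (suc k)) → Fin m
      edge′ zero    = e
      edge′ (suc i) = edge i
      vtx′ : Fin (suc (suc k)) → Fin n
      vtx′ zero    = b (fromℕ k)
      vtx′ (suc i) = a i
      edge-inj′ : ∀ i j → edge′ i ≡ edge′ j → i ≡ j
      edge-inj′ zero    zero    _ = refl
      edge-inj′ zero    (suc j) p = ⊥-elim (edge-in j (sym p))
      edge-inj′ (suc i) zero    p = ⊥-elim (edge-in i p)
      edge-inj′ (suc i) (suc j) p = cong suc (edge-inj i j p)
      last-unmet : ∀ j → b (fromℕ k) ≢ a j
      last-unmet j p = mis (subst (λ z → b (fromℕ k) ≡ a z) (end-meets-start p) p)
      vtx-inj′ : ∀ i j → vtx′ i ≡ vtx′ j → i ≡ j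
      vtx-inj′ zero    zero    _ = refl
      vtx-inj′ zero    (suc j) p = ⊥-elim (last-unmet j p)
      vtx-inj′ (suc i) zero    p = ⊥-elim (last-unmet i (sym p))
      vtx-inj′ (suc i) (suc j) p = cong suc (a-injective i j p)
      end-next : ∀ i → b i ≡ vtx′ (next (suc i))
      end-next i with position i
      ... | last    = cong vtx′ (sym (next-last (suc k)))
      ... | below j = trans (match _ (fromℕ≢inject₁ ∘ sym))
                            (trans (cong a (next-inject₁ j)) (cong vtx′ (sym (next-inject₁ (suc j)))))
      inc′ : ∀ i → IncG G (edge′ i) (vtx′ i) (vtx′ (next i))
      inc′ zero    = subst (IncG G e (b (fromℕ k))) (cong vtx′ (sym (next-inject₁ zero)))
                       (subst (IncG G e (b (fromℕ k)) ∘ a) (next-last k) (mismatch-at-e mis))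
      inc′ (suc i) = subst (IncG G (edge i) (a i)) (end-next i) (Lifted.incident (lift (inc i)))

  module BrokenCircuits (_<_ : Rel (Fin m) 0ℓ) (e-min : ∀ x → x ≢ e → e < x)
                        (X : Pred (Fin m) 0ℓ) (Xe : X e) (nbc : NoBC-G G _<_ X) where
    open Lifting

    matched-⊥ : ∀ C {t} → BrokenIn _<_ X C t → (∀ i → Matched C i) → ⊥
    matched-⊥ C {t} w match = uncurry (nbc (cycle-of-lifts C match) t) w

    -- the only mismatch is the last one: close the lifts with e, which lies
    -- in X and below t
    last-mismatch-⊥ : ∀ C {t} → BrokenIn _<_ X C t → ¬ Matched C (fromℕ (Cycle.k C)) → ⊥
    last-mismatch-⊥ C {t} w mis =
      uncurry (nbc L t) (extend-broken _<_ X {C = C} {C′ = L} (_≡ e) split (λ (i , p) → suc i , p) extra w)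
      where
      L : Cycle (Fin n) _≡_ (λ _ → ⊤) (IncG G)
      L = cycle-through-e C mis λ i i≢last →
            decidable-stable (matched? C i) (λ mis-i → i≢last (mismatch-unique C mis-i mis))
      split : ∀ y → InCycle L y → y ≡ e ⊎ InCycle C y
      split y (zero , p)  = inj₁ (sym p)
      split y (suc i , p) = inj₂ (i , p)
      t≢e : t ≢ e
      t≢e with proj₁ (proj₁ w)
      ... | i , refl = Cycle.edge-in C i
      extra : ∀ y → y ≡ e → y < t × X y
      extra _ refl = e-min t t≢e , Xe

    -- a mismatch at position j (with toℕ j ≡ r) is moved to the last
    -- position by j + 1 rotations
    mismatch-⊥ : ∀ r C {t} → BrokenIn _<_ X C t →
                 (j : Fin (suc (Cycle.k C))) → toℕ j ≡ r → ¬ Matched C j → ⊥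
    mismatch-⊥ _ C w zero _ mis =
      last-mismatch-⊥ (rotate C) (rotate-broken _<_ X {C} w) (subst (¬_ ∘ Matched C) (sym (next-last _)) mis)
    mismatch-⊥ (suc r) C w (suc j) eq mis =
      mismatch-⊥ r (rotate C) (rotate-broken _<_ X {C} w) (inject₁ j) (trans (toℕ-inject₁ j) (ℕ.suc-injective eq))
                 (subst (¬_ ∘ Matched C) (sym (next-inject₁ j)) mis)

    contracted-nbc : NoBrokenCircuit _<_ (Fin n) _≈_ (_≢ e) (IncContr G e) X
    contracted-nbc C t max inX with all? (matched? C)
    ... | yes match = matched-⊥ C (max , inX) match
    ... | no ¬match with ¬∀⟶∃¬ _ (Matched C) (matched? C) ¬match
    ... | j , mis = mismatch-⊥ _ C (max , inX) j refl mis

    -- an edge x ≠ e is not a loop of G|_e: otherwise e and x are parallel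
    -- in G and {e} ⊆ X is a broken circuit
    non-loop : ∀ {x} → x ≢ e → ¬ src G x ≈ tgt G x
    non-loop {x} x≢e (inj₁ s≡t) = lf x s≡t
    non-loop {x} x≢e (inj₂ e∥x) =
      parallel-bc nbc (x≢e ∘ sym) (e-min x x≢e) Xe tt tt (lf x) (lf x ∘ sym) e∥x (inj₂ (refl , refl))

    -- Part (a): an edge x ≠ e of X is the maximum of its class, since a
    -- larger y in the class would be parallel to x in G|_e.
    class-maximal : IsStrictTotalOrder _≡_ _<_ → ∀ {x y} → X x → x ≢ e → _∼e_ G e x y → y ≡ x ⊎ y < x
    class-maximal sto {x} {y} Xx x≢e x∼y with IsStrictTotalOrder.compare sto y x
    ... | tri< y<x _ _ = inj₂ y<x
    ... | tri≈ _ y≡x _ = inj₁ y≡x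
    ... | tri> _ y≢x x<y with class-same-ends x≢e x∼y
    ... | y≢e , ends = ⊥-elim (parallel-bc contracted-nbc (y≢x ∘ sym) x<y Xx x≢e y≢e
                                 (non-loop x≢e) (non-loop x≢e ∘ ≈-sym)
                                 (pair-refl {_R_ = _≈_} ≈-refl) (reversed ends))
      where
      reversed : SameEnds x y → IncContr G e y (tgt G x) (src G x)
      reversed = pair-swapʳ {_R_ = _≈_} ∘ pair-sym {_R_ = _≈_} ≈-sym {src G x} {tgt G x} {src G y} {tgt G y}

lemma3 : {n m : ℕ} (G : Graph n m) → LoopFree G →
         (_<_ : Rel (Fin m) 0ℓ) → IsStrictTotalOrder _≡_ _<_ →
         (e : Fin m) → (∀ x → x ≢ e → e < x) →
         (X : Pred (Fin m) 0ℓ) → X e →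
         NoBC-G G _<_ X →
         (∀ x → X x → x ≢ e → EdgeOfContr G e _<_ x)
         × NoBC-Contr G e _<_ (λ x → X x × x ≢ e)
lemma3 G lf _<_ sto e e-min X Xe nbc =
  (λ x Xx x≢e → x≢e , λ y → class-maximal sto Xx x≢e) ,
  nbc-mono proj₁ proj₁ contracted-nbc
  where
  open Contraction G lf e
  open BrokenCircuits _<_ e-min X Xe nbc
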